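{- Let $G$ be a finite simple graph and let $X$ be an independent set of $G$ with $d(X)>0$ such that $d(Y)<d(X)$ for every proper subset $Y\subsetneq X$. Then $X$ can be expressed as a union of inclusion minimal independent sets with positive difference.
   Context: For $A \subseteq V(G)$, $N(A)$ is the set of vertices adjacent to some vertex of $A$, and $d(A)=|A|-|N(A)|$. An independent set $S$ is an inclusion minimal independent set with positive difference if $d(S)>0$ and no proper subset of $S$ has positive difference. -}

module Defs where

open import Data.Nat using (ℕ)
open import Data.Bool using (Bool; true; false; _∧_)
open import Data.Fin using (Fin)
open import Data.Fin.Subset using (Subset; _∈_; _⊆_; _⊂_; ∣_∣; ⋃)
open import Data.Vec using (tabulate; lookup)
open import Data.List using (List; allFin)
open import Data.Bool.ListAction using (any)
open import Data.Product using (_×_)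
open import Data.Integer using (ℤ; _-_; +_; _<_)
open import Relation.Nullary using (¬_)
open import Relation.Binary.PropositionalEquality using (_≡_)

record Graph (n : ℕ) : Set where
  field
    adj    : Fin n → Fin n → Bool
    adj-sym    : ∀ u v → adj u v ≡ adj v u
    adj-irrefl : ∀ v → adj v v ≡ false

open Graph public

Independent : ∀ {n} → Graph n → Subset n → Set
Independent G S = ∀ u v → u ∈ S → v ∈ S → adj G u v ≡ false

N : ∀ {n} → Graph n → Subset n → Subset n
N {n} G A = tabulate λ v → any (λ a → lookup A a ∧ adj G a v) (allFin n)

d : ∀ {n} → Graph n → Subset n → ℤ
d G A = + ∣ A ∣ - + ∣ N G A ∣

MinPosIndep : ∀ {n} → Graph n → Subset n → Set
MinPosIndep G S =
  Independent G S × (+ 0 < d G S) × (∀ T → T ⊂ S → ¬ (+ 0 < d G T))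

-- Only three properties of d matter: d(∅) = 0, supermodularity
-- d(A) + d(B) ≤ d(A ∪ B) + d(A ∩ B), and d(A - y) ≥ d(A) - 1.  It suffices to
-- put each x ∈ X into a minimal positive subset of X, and this only needs that
-- every Y ⊆ X avoiding x has d(Y) < d(X).  If d(X) = 1, every positive subset
-- of X contains x.  If d(X) ≥ 2, take Z ⊆ X - x minimal with d(Z) ≥ d(X) - 1
-- and some y ∈ Z.  Were there Y ⊆ X - y avoiding x with d(Y) ≥ d(X - y), then
-- d(Y) ≥ d(X) - 1 and d(Y ∪ Z) ≤ d(X) - 1 would give d(Y ∩ Z) ≥ d(X) - 1 by
-- supermodularity, although Y ∩ Z ⊂ Z misses y.  Hence X - y inherits the
-- hypothesis together with d(X - y) > 0, and we recurse on X - y.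
module Submission where

open import Defs
open import Data.Bool using (true; false)
open import Data.Bool.Properties using (T-≡; T-∧)
open import Data.Empty using (⊥-elim)
open import Data.Fin using (Fin; _≟_)
open import Data.Fin.Subset
open import Data.Fin.Subset.Properties
open import Data.Fin.Subset.Induction using (⊂-wellFounded)
open import Data.Integer using (ℤ; +_; 0ℤ; _+_; -_; pred; _≤_; _<_; +≤+)
import Data.Integer.Properties as ℤ
open import Data.Integer.Tactic.RingSolver using (solve-∀)
import Data.Nat as ℕ
import Data.Nat.Properties as ℕ
open import Data.List using (List; []; _∷_; allFin)
open import Data.List.Membership.Propositional using (lose) renaming (_∈_ to _∈ₗ_)
open import Data.List.Membership.Propositional.Properties using (∈-allFin)
open import Data.List.Relation.Unary.All using (All; []; _∷_)
open import Data.List.Relation.Unary.Any using (here; there; satisfied)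
open import Data.List.Relation.Unary.Any.Properties using (any⁻; any⁺)
open import Data.Product using (Σ; ∃-syntax; _×_; _,_; proj₁; proj₂)
open import Data.Sum using (inj₁; inj₂)
open import Data.Vec using ([]; _∷_; here; there)
open import Data.Vec.Properties using (lookup∘tabulate; []=⇒lookup; lookup⇒[]=)
open import Function using (_∘_)
open import Function.Bundles using (Equivalence)
open import Induction.WellFounded using (Acc; acc)
open import Relation.Nullary using (¬_; yes; no)
open import Relation.Nullary.Decidable using (_×-dec_)
open import Relation.Unary using (Decidable)
open import Relation.Binary.PropositionalEquality using (_≡_; _≢_; refl; sym; trans; cong)

open Equivalence using (to; from)

∣p∪q∣+∣p∩q∣≡∣p∣+∣q∣ : ∀ {n} (p q : Subset n) → ∣ p ∪ q ∣ ℕ.+ ∣ p ∩ q ∣ ≡ ∣ p ∣ ℕ.+ ∣ q ∣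
∣p∪q∣+∣p∩q∣≡∣p∣+∣q∣ [] [] = refl
∣p∪q∣+∣p∩q∣≡∣p∣+∣q∣ (true ∷ p) (true ∷ q) =
  cong ℕ.suc (trans (ℕ.+-suc _ _) (trans (cong ℕ.suc (∣p∪q∣+∣p∩q∣≡∣p∣+∣q∣ p q)) (sym (ℕ.+-suc _ _))))
∣p∪q∣+∣p∩q∣≡∣p∣+∣q∣ (true ∷ p) (false ∷ q) = cong ℕ.suc (∣p∪q∣+∣p∩q∣≡∣p∣+∣q∣ p q)
∣p∪q∣+∣p∩q∣≡∣p∣+∣q∣ (false ∷ p) (true ∷ q) =
  trans (cong ℕ.suc (∣p∪q∣+∣p∩q∣≡∣p∣+∣q∣ p q)) (sym (ℕ.+-suc _ _))
∣p∪q∣+∣p∩q∣≡∣p∣+∣q∣ (false ∷ p) (false ∷ q) = ∣p∪q∣+∣p∩q∣≡∣p∣+∣q∣ p q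

∣p∪q∣≤∣p∣+∣q∣ : ∀ {n} (p q : Subset n) → ∣ p ∪ q ∣ ℕ.≤ ∣ p ∣ ℕ.+ ∣ q ∣
∣p∪q∣≤∣p∣+∣q∣ p q = ℕ.≤-trans (ℕ.m≤m+n _ _) (ℕ.≤-reflexive (∣p∪q∣+∣p∩q∣≡∣p∣+∣q∣ p q))

∣p∣≤1+∣p-x∣ : ∀ {n} (p : Subset n) x → ∣ p ∣ ℕ.≤ ℕ.suc ∣ p - x ∣
∣p∣≤1+∣p-x∣ p x = begin
  ∣ p ∣                     ≤⟨ p⊆q⇒∣p∣≤∣q∣ p⊆p-x∪⁅x⁆ ⟩
  ∣ (p - x) ∪ ⁅ x ⁆ ∣       ≤⟨ ∣p∪q∣≤∣p∣+∣q∣ (p - x) ⁅ x ⁆ ⟩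
  ∣ p - x ∣ ℕ.+ ∣ ⁅ x ⁆ ∣   ≡⟨ cong (∣ p - x ∣ ℕ.+_) (∣⁅x⁆∣≡1 x) ⟩
  ∣ p - x ∣ ℕ.+ 1           ≡⟨ ℕ.+-comm _ 1 ⟩
  ℕ.suc ∣ p - x ∣           ∎
  where
  open ℕ.≤-Reasoning
  p⊆p-x∪⁅x⁆ : p ⊆ (p - x) ∪ ⁅ x ⁆
  p⊆p-x∪⁅x⁆ {y} y∈p with y ≟ x
  ... | yes refl = x∈p∪q⁺ (inj₂ (x∈⁅x⁆ x))
  ... | no y≢x   = x∈p∪q⁺ (inj₁ (x∈p∧x≢y⇒x∈p-y y∈p y≢x))

x∈p─q⇒x∉q : ∀ {n} (p q : Subset n) {x} → x ∈ p ─ q → x ∉ q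
x∈p─q⇒x∉q (_ ∷ p) (outside ∷ q) here          ()
x∈p─q⇒x∉q (_ ∷ p) (_       ∷ q) (there x∈p─q) (there x∈q) = x∈p─q⇒x∉q p q x∈p─q x∈q

x∈p-y⇒x≢y : ∀ {n} {p : Subset n} {x y} → x ∈ p - y → x ≢ y
x∈p-y⇒x≢y {p = p} {y = y} x∈p-y = x∉⁅y⁆⇒x≢y (x∈p─q⇒x∉q p ⁅ y ⁆ x∈p-y)

∪-⊆ : ∀ {n} {p q r : Subset n} → p ⊆ r → q ⊆ r → p ∪ q ⊆ r
∪-⊆ {p = p} {q} p⊆r q⊆r x∈p∪q with x∈p∪q⁻ p q x∈p∪q
... | inj₁ x∈p = p⊆r x∈p
... | inj₂ x∈q = q⊆r x∈q

Minimal : ∀ {n} → (Subset n → Set) → Subset n → Set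
Minimal P B = P B × (∀ C → C ⊂ B → ¬ P C)

minimal-⊆ : ∀ {n} {P : Subset n → Set} → Decidable P → ∀ {A} → P A → ∃[ B ] B ⊆ A × Minimal P B
minimal-⊆ {P = P} P? {A} pA = go (⊂-wellFounded A) pA
  where
  go : ∀ {A} → Acc _⊂_ A → P A → ∃[ B ] B ⊆ A × Minimal P B
  go {A} (acc rs) pA with anySubset? (λ C → (C ⊂? A) ×-dec P? C)
  ... | no none = A , (λ x∈A → x∈A) , pA , λ C C⊂A pC → none (C , C⊂A , pC)
  ... | yes (C , C⊂A , pC) with go (rs C⊂A) pC
  ...   | B , B⊆C , minB = B , (λ x∈B → p⊂q⇒p⊆q C⊂A (B⊆C x∈B)) , minB

⋃-of-witnesses : ∀ {n} {P : Subset n → Set} {X : Subset n} →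
                 (∀ {x} → x ∈ X → ∃[ S ] S ⊆ X × x ∈ S × P S) →
                 ∃[ Ss ] All P Ss × ⋃ Ss ≡ X
⋃-of-witnesses {n} {P} {X} witness =
  let Ss , allP , ⋃⊆X , covers = go (allFin n)
  in Ss , allP , ⊆-antisym ⋃⊆X (λ {x} → covers (∈-allFin x))
  where
  go : ∀ xs → ∃[ Ss ] All P Ss × ⋃ Ss ⊆ X × (∀ {x} → x ∈ₗ xs → x ∈ X → x ∈ ⋃ Ss)
  go [] = [] , [] , (λ x∈⊥ → ⊥-elim (∉⊥ x∈⊥)) , λ ()
  go (z ∷ zs) with go zs | z ∈? X
  ... | Ss , allP , ⋃⊆X , covers | no z∉X =
    Ss , allP , ⋃⊆X , λ { (here refl) z∈X → ⊥-elim (z∉X z∈X) ; (there x∈zs) → covers x∈zs }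
  ... | Ss , allP , ⋃⊆X , covers | yes z∈X with witness z∈X
  ...   | S , S⊆X , z∈S , pS =
    S ∷ Ss , pS ∷ allP , ∪-⊆ S⊆X ⋃⊆X ,
    λ { (here refl) _ → x∈p∪q⁺ (inj₁ z∈S) ; (there x∈zs) x∈X → x∈p∪q⁺ (inj₂ (covers x∈zs x∈X)) }

[a-p]+[b-q]≡[a+b]-[p+q] : ∀ a p b q → (+ a + - + p) + (+ b + - + q) ≡ + (a ℕ.+ b) + - + (p ℕ.+ q)
[a-p]+[b-q]≡[a+b]-[p+q] a p b q rewrite ℤ.pos-+ a b | ℤ.pos-+ p q = interchange (+ a) (+ p) (+ b) (+ q)
  where
  interchange : ∀ a p b q → (a + - p) + (b + - q) ≡ (a + b) + - (p + q)
  interchange = solve-∀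

≤-of-sum : ∀ {m a b c e} → m ≤ a → m ≤ b → a + b ≤ e + c → e ≤ m → m ≤ c
≤-of-sum {m} {a} {b} {c} {e} m≤a m≤b a+b≤e+c e≤m = begin
  m                ≡⟨ m≡[m+m]-m m ⟩
  (m + m) + - m    ≤⟨ ℤ.+-monoˡ-≤ (- m) (ℤ.+-mono-≤ m≤a m≤b) ⟩
  (a + b) + - m    ≤⟨ ℤ.+-monoˡ-≤ (- m) a+b≤e+c ⟩
  (e + c) + - m    ≤⟨ ℤ.+-monoˡ-≤ (- m) (ℤ.+-monoˡ-≤ c e≤m) ⟩
  (m + c) + - m    ≡⟨ [m+c]-m≡c m c ⟩
  c                ∎
  where
  open ℤ.≤-Reasoning
  m≡[m+m]-m : ∀ m → m ≡ (m + m) + - m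
  m≡[m+m]-m = solve-∀
  [m+c]-m≡c : ∀ m c → (m + c) + - m ≡ c
  [m+c]-m≡c = solve-∀

module SupermodularSetFunction {n : ℕ.ℕ} (f : Subset n → ℤ)
  (f-⊥ : f ⊥ ≡ 0ℤ)
  (f-supermodular : ∀ A B → f A + f B ≤ f (A ∪ B) + f (A ∩ B))
  (pred-f≤f-delete : ∀ A y → pred (f A) ≤ f (A - y))
  where

  Positive : Subset n → Set
  Positive A = 0ℤ < f A

  Essential : Subset n → Fin n → Set
  Essential X x = ∀ Y → Y ⊆ X → x ∉ Y → f Y < f X

  positive⇒nonempty : ∀ {A} → Positive A → Nonempty A
  positive⇒nonempty {A} 0<fA with nonempty? A
  ... | yes ne = ne
  ... | no empty = ⊥-elim (ℤ.<-irrefl (sym (trans (cong f (Empty-unique empty)) f-⊥)) 0<fA)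

  essential-delete : ∀ {X x y Z} → Essential X x → Z ⊆ X - x →
                     Minimal (λ W → pred (f X) ≤ f W) Z → y ∈ Z → Essential (X - y) x
  essential-delete {X} {x} {y} {Z} ess Z⊆X-x (level-Z , minZ) y∈Z Y Y⊆X-y x∉Y
    with f Y ℤ.<? f (X - y)
  ... | yes fY<fX-y = fY<fX-y
  ... | no  fY≮fX-y = ⊥-elim (minZ (Y ∩ Z) Y∩Z⊂Z level-Y∩Z)
    where
    level-Y : pred (f X) ≤ f Y
    level-Y = ℤ.≤-trans (pred-f≤f-delete X y) (ℤ.≮⇒≥ fY≮fX-y)
    Y∪Z⊆X : Y ∪ Z ⊆ X
    Y∪Z⊆X = ∪-⊆ (p─q⊆p X ⁅ y ⁆ ∘ Y⊆X-y) (p─q⊆p X ⁅ x ⁆ ∘ Z⊆X-x)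
    x∉Y∪Z : x ∉ Y ∪ Z
    x∉Y∪Z x∈Y∪Z with x∈p∪q⁻ Y Z x∈Y∪Z
    ... | inj₁ x∈Y = x∉Y x∈Y
    ... | inj₂ x∈Z = x∈p-y⇒x≢y (Z⊆X-x x∈Z) refl
    level-Y∩Z : pred (f X) ≤ f (Y ∩ Z)
    level-Y∩Z = ≤-of-sum level-Y level-Z (f-supermodular Y Z)
                  (ℤ.i<j⇒i≤pred[j] (ess (Y ∪ Z) Y∪Z⊆X x∉Y∪Z))
    Y∩Z⊂Z : Y ∩ Z ⊂ Z
    Y∩Z⊂Z = p∩q⊆q Y Z , y , y∈Z , λ y∈Y∩Z → x∈p-y⇒x≢y (Y⊆X-y (p∩q⊆p Y Z y∈Y∩Z)) refl

  essential∈positive : ∀ {X x S} → Essential X x → pred (f X) ≤ 0ℤ → S ⊆ X → Positive S → x ∈ S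
  essential∈positive {X} {x} {S} ess fX≤1 S⊆X 0<fS with x ∈? S
  ... | yes x∈S = x∈S
  ... | no  x∉S = ⊥-elim (ℤ.<⇒≱ 0<fS (ℤ.≤-trans (ℤ.i<j⇒i≤pred[j] (ess S S⊆X x∉S)) fX≤1))

  essential∈minimal-positive : ∀ {X x} → Acc _⊂_ X → x ∈ X → Positive X → Essential X x →
                               ∃[ S ] S ⊆ X × x ∈ S × Minimal Positive S
  essential∈minimal-positive {X} {x} (acc rec) x∈X 0<fX ess with 0ℤ ℤ.<? pred (f X)
  ... | no fX≯1 =
    let S , S⊆X , minS = minimal-⊆ (λ A → 0ℤ ℤ.<? f A) 0<fX
    in  S , S⊆X , essential∈positive ess (ℤ.≮⇒≥ fX≯1) S⊆X (proj₁ minS) , minS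
  ... | yes fX>1 =
    let Z , Z⊆X-x , minZ = minimal-⊆ (λ W → pred (f X) ℤ.≤? f W) (pred-f≤f-delete X x)
        y , y∈Z = positive⇒nonempty (ℤ.<-≤-trans fX>1 (proj₁ minZ))
        y∈X = p─q⊆p X ⁅ x ⁆ (Z⊆X-x y∈Z)
        x∈X-y = x∈p∧x≢y⇒x∈p-y x∈X (λ x≡y → x∈p-y⇒x≢y (Z⊆X-x y∈Z) (sym x≡y))
        S , S⊆X-y , x∈S , minS =
          essential∈minimal-positive (rec (x∈p⇒p-x⊂p y∈X)) x∈X-y
            (ℤ.<-≤-trans fX>1 (pred-f≤f-delete X y)) (essential-delete ess Z⊆X-x minZ y∈Z)
    in  S , p─q⊆p X ⁅ y ⁆ ∘ S⊆X-y , x∈S , minS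

module _ {n : ℕ.ℕ} (G : Graph n) where

  ∈N⁻ : ∀ {A v} → v ∈ N G A → ∃[ a ] a ∈ A × adj G a v ≡ true
  ∈N⁻ {A} {v} v∈NA =
    let a , a∈A∧adj = satisfied (any⁻ _ (allFin n) (from T-≡ (trans (sym (lookup∘tabulate _ v)) ([]=⇒lookup v∈NA))))
        a∈A , adj-av = to T-∧ a∈A∧adj
    in a , lookup⇒[]= a A (to T-≡ a∈A) , to T-≡ adj-av

  ∈N⁺ : ∀ {A v a} → a ∈ A → adj G a v ≡ true → v ∈ N G A
  ∈N⁺ {A} {v} {a} a∈A adj-av = lookup⇒[]= v (N G A) (trans (lookup∘tabulate _ v)
    (to T-≡ (any⁺ _ (lose (∈-allFin a) (from T-∧ (from T-≡ ([]=⇒lookup a∈A) , from T-≡ adj-av))))))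

  N-mono : ∀ {A B} → A ⊆ B → N G A ⊆ N G B
  N-mono A⊆B v∈NA = let a , a∈A , adj-av = ∈N⁻ v∈NA in ∈N⁺ (A⊆B a∈A) adj-av

  N-∪ : ∀ A B → N G (A ∪ B) ⊆ N G A ∪ N G B
  N-∪ A B v∈N with ∈N⁻ v∈N
  ... | a , a∈A∪B , adj-av with x∈p∪q⁻ A B a∈A∪B
  ...   | inj₁ a∈A = x∈p∪q⁺ (inj₁ (∈N⁺ a∈A adj-av))
  ...   | inj₂ a∈B = x∈p∪q⁺ (inj₂ (∈N⁺ a∈B adj-av))

  N-∩ : ∀ A B → N G (A ∩ B) ⊆ N G A ∩ N G B
  N-∩ A B v∈N = x∈p∩q⁺ (N-mono (p∩q⊆p A B) v∈N , N-mono (p∩q⊆q A B) v∈N)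

  N-⊥ : N G ⊥ ≡ ⊥
  N-⊥ = Empty-unique λ (v , v∈N⊥) → ∉⊥ (proj₁ (proj₂ (∈N⁻ v∈N⊥)))

  ∣N∣-submodular : ∀ A B → ∣ N G (A ∪ B) ∣ ℕ.+ ∣ N G (A ∩ B) ∣ ℕ.≤ ∣ N G A ∣ ℕ.+ ∣ N G B ∣
  ∣N∣-submodular A B = ℕ.≤-trans (ℕ.+-mono-≤ (p⊆q⇒∣p∣≤∣q∣ (N-∪ A B)) (p⊆q⇒∣p∣≤∣q∣ (N-∩ A B)))
    (ℕ.≤-reflexive (∣p∪q∣+∣p∩q∣≡∣p∣+∣q∣ (N G A) (N G B)))

  d-⊥ : d G ⊥ ≡ 0ℤ
  d-⊥ = trans (cong (λ B → + ∣ ⊥ {n = n} ∣ + - + ∣ B ∣) N-⊥) (ℤ.+-inverseʳ (+ ∣ ⊥ {n = n} ∣))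

  d-supermodular : ∀ A B → d G A + d G B ≤ d G (A ∪ B) + d G (A ∩ B)
  d-supermodular A B = begin
    (d G A + d G B)
      ≡⟨ [a-p]+[b-q]≡[a+b]-[p+q] (∣ A ∣) (∣ N G A ∣) (∣ B ∣) (∣ N G B ∣) ⟩
    (+ (∣ A ∣ ℕ.+ ∣ B ∣) + - + (∣ N G A ∣ ℕ.+ ∣ N G B ∣))
      ≡⟨ cong (λ k → + k + - + (∣ N G A ∣ ℕ.+ ∣ N G B ∣)) (sym (∣p∪q∣+∣p∩q∣≡∣p∣+∣q∣ A B)) ⟩
    (+ (∣ A ∪ B ∣ ℕ.+ ∣ A ∩ B ∣) + - + (∣ N G A ∣ ℕ.+ ∣ N G B ∣))
      ≤⟨ ℤ.+-monoʳ-≤ (+ _) (ℤ.neg-mono-≤ (+≤+ (∣N∣-submodular A B))) ⟩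
    (+ (∣ A ∪ B ∣ ℕ.+ ∣ A ∩ B ∣) + - + (∣ N G (A ∪ B) ∣ ℕ.+ ∣ N G (A ∩ B) ∣))
      ≡⟨ sym ([a-p]+[b-q]≡[a+b]-[p+q] (∣ A ∪ B ∣) (∣ N G (A ∪ B) ∣) (∣ A ∩ B ∣) (∣ N G (A ∩ B) ∣)) ⟩
    (d G (A ∪ B) + d G (A ∩ B)) ∎
    where open ℤ.≤-Reasoning

  pred-d≤d-delete : ∀ A y → pred (d G A) ≤ d G (A - y)
  pred-d≤d-delete A y = begin
    pred (d G A)
      ≡⟨ sym (ℤ.pred-+ (+ ∣ A ∣) _) ⟩
    (pred (+ ∣ A ∣) + - + ∣ N G A ∣)
      ≤⟨ ℤ.+-mono-≤ (ℤ.pred-mono (+≤+ (∣p∣≤1+∣p-x∣ A y)))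
                    (ℤ.neg-mono-≤ (+≤+ (p⊆q⇒∣p∣≤∣q∣ (N-mono (p─q⊆p A ⁅ y ⁆))))) ⟩
    d G (A - y) ∎
    where open ℤ.≤-Reasoning

independent-⊆ : ∀ {n} (G : Graph n) {S X} → S ⊆ X → Independent G X → Independent G S
independent-⊆ G S⊆X indX u v u∈S v∈S = indX u v (S⊆X u∈S) (S⊆X v∈S)

corollary2p8 : ∀ {n} (G : Graph n) (X : Subset n)
    → Independent G X
    → + 0 < d G X
    → (∀ Y → Y ⊂ X → d G Y < d G X)
    → Σ (List (Subset n)) λ Ss → All (MinPosIndep G) Ss × ⋃ Ss ≡ X
corollary2p8 G X indX 0<dX dY<dX = ⋃-of-witnesses witness
  where
  open SupermodularSetFunction (d G) (d-⊥ G) (d-supermodular G) (pred-d≤d-delete G)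
  witness : ∀ {x} → x ∈ X → ∃[ S ] S ⊆ X × x ∈ S × MinPosIndep G S
  witness x∈X with essential∈minimal-positive (⊂-wellFounded X) x∈X 0<dX
                     (λ Y Y⊆X x∉Y → dY<dX Y (Y⊆X , _ , x∈X , x∉Y))
  ... | S , S⊆X , x∈S , minS = S , S⊆X , x∈S , independent-⊆ G S⊆X indX , minS
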